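{- Let $2k+1$ be a prime. Every finite simple graph is an induced subgraph of some finite simple graph that admits a $(2k+1)$-neighborhood balanced coloring.
   Context: For a prime $2k+1$ (with $k\ge 1$), a $(2k+1)$-neighborhood balanced coloring of a finite simple graph is an assignment to each vertex of one of $2k+1$ colors $R_1,\dots,R_{2k+1}$ such that every vertex has an equal number of neighbors of each color. -}

module Defs where

open import Data.Nat using (ℕ; suc; _+_)
open import Data.Bool using (Bool; true; false; if_then_else_; _∧_)
open import Data.Fin using (Fin)
open import Data.Fin.Properties using (_≟_)
open import Data.List using (List; length; filterᵇ)
open import Data.Fin.Base using () 
open import Data.List using (allFin)
open import Relation.Nullary.Decidable using (⌊_⌋)
open import Relation.Binary.PropositionalEquality using (_≡_)
open import Function.Definitions using (Injective)

record SimpleGraph (n : ℕ) : Set where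
  field
    Adj   : Fin n → Fin n → Bool
    symm  : ∀ u v → Adj u v ≡ Adj v u
    irrfl : ∀ v → Adj v v ≡ false
open SimpleGraph public

nbrCount : ∀ {n r} → SimpleGraph n → (Fin n → Fin r) → Fin n → Fin r → ℕ
nbrCount {n} G col v c =
  length (filterᵇ (λ u → Adj G v u ∧ ⌊ col u ≟ c ⌋ ) (allFin n))

IsNbhdBalanced : ∀ {n} (r : ℕ) → SimpleGraph n → (Fin n → Fin r) → Set
IsNbhdBalanced {n} r G col = ∀ (v : Fin n) (c c' : Fin r) → nbrCount G col v c ≡ nbrCount G col v c'

record InducedEmbedding {n m : ℕ} (G : SimpleGraph n) (H : SimpleGraph m) : Set where
  field
    emb      : Fin n → Fin m
    emb-inj  : Injective _≡_ _≡_ emb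
    emb-adj  : ∀ u v → Adj H (emb u) (emb v) ≡ Adj G u v

-- Blow every vertex v of G up into r pairwise non-adjacent copies (v , 0) … (v , r-1),
-- joining (v , j) to (u , j') exactly when v ~ u, and colour (v , j) by j. The neighbours
-- of (v , j) are all r copies of each neighbour of v, so every colour occurs deg v times
-- around it, and one layer of copies is an induced copy of G.
module Submission where

open import Defs
open import Data.Nat using (ℕ; zero; suc; _+_; _*_; _≤_)
open import Data.Nat.Primality using (Prime)
open import Data.Nat.Properties using (m≤n+m)
open import Data.Product using (Σ; _×_; _,_; proj₁; proj₂)
open import Data.Fin using (Fin; zero; suc; _↑ˡ_; _↑ʳ_; combine; quotient; remainder; fromℕ<)
open import Data.Fin.Properties using (_≟_; remQuot-combine)
open import Data.Bool using (Bool; true; false; if_then_else_; _∧_)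
open import Data.Bool.Properties using (if-float)
open import Data.List using (length; filterᵇ; tabulate)
open import Function using (_∘_)
open import Relation.Nullary using (yes; no)
open import Relation.Nullary.Decidable using (⌊_⌋)
open import Relation.Binary.PropositionalEquality
open ≡-Reasoning

count : ∀ {n} → (Fin n → Bool) → ℕ
count {zero}  p = 0
count {suc n} p = if p zero then suc (count (p ∘ suc)) else count (p ∘ suc)

length-filterᵇ-tabulate : ∀ {A : Set} {n} (p : A → Bool) (g : Fin n → A) →
                          length (filterᵇ p (tabulate g)) ≡ count (p ∘ g)
length-filterᵇ-tabulate {n = zero}  p g = refl
length-filterᵇ-tabulate {n = suc n} p g with p (g zero)
... | true  = cong suc (length-filterᵇ-tabulate p (g ∘ suc))
... | false = length-filterᵇ-tabulate p (g ∘ suc)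

count-cong : ∀ {n} {p q : Fin n → Bool} → (∀ i → p i ≡ q i) → count p ≡ count q
count-cong {zero}  eq = refl
count-cong {suc n} {p} {q} eq rewrite eq zero =
  cong (λ m → if q zero then suc m else m) (count-cong (eq ∘ suc))

count-↑ : ∀ m {n} (p : Fin (m + n) → Bool) →
          count p ≡ count (p ∘ (_↑ˡ n)) + count (p ∘ (m ↑ʳ_))
count-↑ zero    p = refl
count-↑ (suc m) p with p zero
... | true  = cong suc (count-↑ m (p ∘ suc))
... | false = count-↑ m (p ∘ suc)

count-const-false : ∀ n → count {n} (λ _ → false) ≡ 0
count-const-false zero    = refl
count-const-false (suc n) = count-const-false n

count-≟ : ∀ {r} (c : Fin r) → count (λ j → ⌊ j ≟ c ⌋) ≡ 1
count-≟ {suc r} zero    = cong suc (count-const-false r)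
count-≟ {suc r} (suc c) = trans (count-cong suc-≟) (count-≟ c)
  where
  suc-≟ : ∀ j → ⌊ suc j ≟ suc c ⌋ ≡ ⌊ j ≟ c ⌋
  suc-≟ j with j ≟ c
  ... | yes _ = refl
  ... | no  _ = refl

count-∧-≟ : ∀ {r} (b : Bool) (c : Fin r) → count (λ j → b ∧ ⌊ j ≟ c ⌋) ≡ (if b then 1 else 0)
count-∧-≟ {r} true  c = count-≟ c
count-∧-≟ {r} false c = count-const-false r

count-combine-∧-≟ : ∀ {n r} (p : Fin n → Bool) (c : Fin r) (h : Fin (n * r) → Bool) →
                    (∀ i j → h (combine i j) ≡ p i ∧ ⌊ j ≟ c ⌋) → count h ≡ count p
count-combine-∧-≟ {zero}      p c h eq = refl
count-combine-∧-≟ {suc n} {r} p c h eq = begin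
  count h
    ≡⟨ count-↑ r h ⟩
  count (h ∘ (_↑ˡ n * r)) + count (h ∘ (r ↑ʳ_))
    ≡⟨ cong₂ _+_ (count-cong (eq zero))
                 (count-combine-∧-≟ (p ∘ suc) c (h ∘ (r ↑ʳ_)) (eq ∘ suc)) ⟩
  count (λ j → p zero ∧ ⌊ j ≟ c ⌋) + count (p ∘ suc)
    ≡⟨ cong (_+ count (p ∘ suc)) (count-∧-≟ (p zero) c) ⟩
  (if p zero then 1 else 0) + count (p ∘ suc)
    ≡⟨ if-float (_+ count (p ∘ suc)) (p zero) ⟩
  count p
    ∎

quotient-combine : ∀ {n r} (i : Fin n) (j : Fin r) → quotient r (combine i j) ≡ i
quotient-combine {n} {r} i j = cong proj₁ (remQuot-combine {n} {r} i j)

remainder-combine : ∀ {n r} (i : Fin n) (j : Fin r) → remainder {n} r (combine i j) ≡ j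
remainder-combine {n} {r} i j = cong proj₂ (remQuot-combine {n} {r} i j)

-- The lexicographic product G[K̄ r]; vertex combine v j of Fin (n * r) is the j-th copy of v.
blowUp : ∀ {n} r → SimpleGraph n → SimpleGraph (n * r)
blowUp {n} r G = record
  { Adj   = λ x y → Adj G (quotient {n} r x) (quotient {n} r y)
  ; symm  = λ x y → symm G _ _
  ; irrfl = λ x → irrfl G _
  }

module _ {n r : ℕ} (G : SimpleGraph n) where

  layer-embedding : Fin r → InducedEmbedding G (blowUp r G)
  layer-embedding j = record
    { emb     = λ v → combine v j
    ; emb-inj = λ {u} {v} e →
        trans (sym (quotient-combine u j)) (trans (cong (quotient {n} r) e) (quotient-combine v j))
    ; emb-adj = λ u v → cong₂ (Adj G) (quotient-combine u j) (quotient-combine v j)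
    }

  nbrCount-blowUp : ∀ x c → nbrCount (blowUp r G) (remainder {n} r) x c ≡ count (Adj G (quotient {n} r x))
  nbrCount-blowUp x c = begin
    length (filterᵇ neighbour-of-colour-c (tabulate (λ y → y)))
      ≡⟨ length-filterᵇ-tabulate neighbour-of-colour-c (λ y → y) ⟩
    count neighbour-of-colour-c
      ≡⟨ count-combine-∧-≟ (Adj G (quotient {n} r x)) c neighbour-of-colour-c (λ i j →
           cong₂ (λ u k → Adj G (quotient {n} r x) u ∧ ⌊ k ≟ c ⌋)
                 (quotient-combine i j) (remainder-combine i j)) ⟩
    count (Adj G (quotient {n} r x))
      ∎
    where
    neighbour-of-colour-c : Fin (n * r) → Bool
    neighbour-of-colour-c y = Adj (blowUp r G) x y ∧ ⌊ remainder {n} r y ≟ c ⌋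

  blowUp-balanced : IsNbhdBalanced r (blowUp r G) (remainder {n} r)
  blowUp-balanced x c c′ = trans (nbrCount-blowUp x c) (sym (nbrCount-blowUp x c′))

theorem2p16 : (k : ℕ) → 1 ≤ k → Prime (2 * k + 1) →
    ∀ (n : ℕ) (G : SimpleGraph n) →
      Σ ℕ λ m → Σ (SimpleGraph m) λ H →
        InducedEmbedding G H × Σ (Fin m → Fin (2 * k + 1)) λ col → IsNbhdBalanced (2 * k + 1) H col
theorem2p16 k _ _ n G =
  n * r , blowUp r G , layer-embedding G (fromℕ< (m≤n+m 1 (2 * k))) , remainder {n} r , blowUp-balanced G
  where
  r = 2 * k + 1
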